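{- Let $E$ be a principal ideal domain, let $f_1,f_2\in E[x]$ with $\gcd(f_1,f_2)=1$, let $R_i=E[x]/(f_i)$, suppose $E[x]/(f_1,f_2)$ is finite, and for $i=1,2$ let $(R_i,X,N_i)$ be an irredundant digit system. Suppose there exists $\tilde d\in E[x]$ with $d\equiv\tilde d\pmod{(f_1,f_2)}$ for all $d\in N_1\cup N_2$. Then $f_1(0)$ and $f_2(0)$ are coprime in $E$ (i.e. $\gcd(f_1(0),f_2(0))$ is a unit).
   Context: A digit system is a triple $(V,\phi,D)$ with $V$ an abelian group, $\phi$ an endomorphism with $V/\phi(V)$ finite, and $D\subseteq V$ finite meeting every coset of $\phi(V)$; it is irredundant if $D$ contains exactly one element of each coset. $X$ is multiplication by the residue class of $x$. $(f_1,f_2)$ is the ideal of $E[x]$ generated by $f_1,f_2$. -}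

module Defs where

open import Level using (Level; _⊔_)
open import Algebra.Bundles using (CommutativeRing)
open import Data.Nat using (ℕ; zero; suc)
open import Data.List using (List; []; _∷_; map; length; lookup)
open import Data.List.Membership.Setoid using ()
open import Data.List.Relation.Unary.Any using (Any)
open import Data.Fin using (Fin)
open import Data.Product using (Σ; ∃; _×_; _,_)
open import Relation.Binary.PropositionalEquality using (_≡_)
open import Relation.Nullary using (¬_)

module Poly {c ℓ : Level} (E : CommutativeRing c ℓ) where
  open CommutativeRing E

  _∣E_ : Carrier → Carrier → Set (c ⊔ ℓ)
  a ∣E b = ∃ λ k → b ≈ k * a

  IsUnitE : Carrier → Set (c ⊔ ℓ)
  IsUnitE a = a ∣E 1#

  CoprimeE : Carrier → Carrier → Set (c ⊔ ℓ)
  CoprimeE a b = ∀ g → g ∣E a → g ∣E b → IsUnitE g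

  IsIntegralDomain : Set (c ⊔ ℓ)
  IsIntegralDomain = (¬ (1# ≈ 0#)) × (∀ a b → a * b ≈ 0# → (a ≈ 0#) Data.Sum.⊎ (b ≈ 0#))
    where import Data.Sum

  record IsIdeal (I : Carrier → Set (c ⊔ ℓ)) : Set (c ⊔ ℓ) where
    field
      resp  : ∀ {a b} → a ≈ b → I a → I b
      zero∈ : I 0#
      +∈    : ∀ {a b} → I a → I b → I (a + b)
      *∈    : ∀ r {a} → I a → I (r * a)

  IsPID : Set (Level.suc (c ⊔ ℓ))
  IsPID = IsIntegralDomain ×
          (∀ (I : Carrier → Set (c ⊔ ℓ)) → IsIdeal I →
             ∃ λ g → ∀ a → (I a → g ∣E a) × (g ∣E a → I a))

  -- Polynomials E[x]: coefficient lists, constant term first.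

  Pol : Set c
  Pol = List Carrier

  coeff : Pol → ℕ → Carrier
  coeff []       _       = 0#
  coeff (a ∷ p) zero    = a
  coeff (a ∷ p) (suc n) = coeff p n

  _≈P_ : Pol → Pol → Set ℓ
  p ≈P q = ∀ n → coeff p n ≈ coeff q n

  _+P_ : Pol → Pol → Pol
  []      +P q       = q
  (a ∷ p) +P []      = a ∷ p
  (a ∷ p) +P (b ∷ q) = (a + b) ∷ (p +P q)

  -P_ : Pol → Pol
  -P p = map -_ p

  _-P_ : Pol → Pol → Pol
  p -P q = p +P (-P q)

  _·P_ : Carrier → Pol → Pol
  a ·P p = map (a *_) p

  _*P_ : Pol → Pol → Pol
  []      *P q = []
  (a ∷ p) *P q = (a ·P q) +P (0# ∷ (p *P q))

  oneP : Pol
  oneP = 1# ∷ []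

  xP : Pol
  xP = 0# ∷ 1# ∷ []

  at0 : Pol → Carrier
  at0 p = coeff p 0

  _∣P_ : Pol → Pol → Set (c ⊔ ℓ)
  g ∣P f = ∃ λ k → f ≈P (k *P g)

  CoprimeP : Pol → Pol → Set (c ⊔ ℓ)
  CoprimeP f₁ f₂ = ∀ g → g ∣P f₁ → g ∣P f₂ → g ∣P oneP

  _≡_mod₁_ : Pol → Pol → Pol → Set (c ⊔ ℓ)
  p ≡ q mod₁ f = ∃ λ u → (p -P q) ≈P (u *P f)

  _≡_mod₂_,_ : Pol → Pol → Pol → Pol → Set (c ⊔ ℓ)
  p ≡ q mod₂ f , g = ∃ λ u → ∃ λ v → (p -P q) ≈P ((u *P f) +P (v *P g))

  FiniteQuot₂ : Pol → Pol → Set (c ⊔ ℓ)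
  FiniteQuot₂ f g = ∃ λ (L : List Pol) → ∀ p → Any (λ q → p ≡ q mod₂ f , g) L

  -- Digit systems on R = E[x]/(f) with φ = X (multiplication by x).
  -- Elements of R are represented by polynomials (R is the setoid quotient).
  -- The image X(R) = (x R) and two elements a, b of R lie in the same coset
  -- of X(R) iff a - b ∈ (x, f) in E[x].

  SameCosetX : Pol → Pol → Pol → Set (c ⊔ ℓ)
  SameCosetX f a b = a ≡ b mod₂ xP , f

  record IrredundantDigitSystem (f : Pol) (D : List Pol) : Set (c ⊔ ℓ) where
    field
      quotFinite : ∃ λ (L : List Pol) → ∀ a → Any (SameCosetX f a) L
      covers     : ∀ a → Any (SameCosetX f a) D
      unique     : ∀ (i j : Fin (length D)) →
                     SameCosetX f (lookup D i) (lookup D j) → i ≡ j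

{-# OPTIONS --safe #-}
-- Let g divide f₁(0) and f₂(0). Evaluation at 0 is a ring homomorphism
-- E[x] → E sending both ideals (x, f₁) and (f₁, f₂) into gE. Every
-- polynomial is congruent modulo (x, f₁) to some digit of N₁, which is
-- congruent to d̃ modulo (f₁, f₂); so every constant of E is congruent to
-- d̃(0) modulo g. In particular 1 ≡ 0 modulo g, i.e. g is a unit.
module Submission where

open import Defs
open import Level using (Level; _⊔_)
open import Function using (_∘′_)
open import Algebra.Bundles using (CommutativeRing)
open import Data.List using (List; _++_; []; _∷_)
open import Data.List.Relation.Unary.All using (All)
import Data.List.Relation.Unary.All as All
open import Data.List.Relation.Unary.All.Properties using (++⁻ˡ)
open import Data.List.Relation.Unary.Any using (Any)
import Data.List.Relation.Unary.Any as Any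
open import Data.Product using (∃; _,_)
import Algebra.Properties.Ring as RingProperties
import Algebra.Properties.AbelianGroup as AbelianGroupProperties
import Relation.Binary.Reasoning.Setoid as SetoidReasoning

module _ {c ℓ : Level} (E : CommutativeRing c ℓ) where
  open CommutativeRing E
  open Poly E
  open RingProperties ring using (-‿distribˡ-*; -0#≈0#)
  open AbelianGroupProperties +-abelianGroup using (⁻¹-anti-homo‿-)
  open SetoidReasoning setoid

  module _ {g : Carrier} where

    ∣E-resp : ∀ {a b} → a ≈ b → g ∣E a → g ∣E b
    ∣E-resp a≈b (k , a≈kg) = k , trans (sym a≈b) a≈kg

    ∣E-+ : ∀ {a b} → g ∣E a → g ∣E b → g ∣E (a + b)
    ∣E-+ (k , a≈kg) (l , b≈lg) = k + l , trans (+-cong a≈kg b≈lg) (sym (distribʳ g k l))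

    ∣E-*ˡ : ∀ r {a} → g ∣E a → g ∣E (r * a)
    ∣E-*ˡ r (k , a≈kg) = r * k , trans (*-congˡ a≈kg) (sym (*-assoc r k g))

    ∣E-‿ : ∀ {a} → g ∣E a → g ∣E (- a)
    ∣E-‿ (k , a≈kg) = - k , trans (-‿cong a≈kg) (-‿distribˡ-* k g)

  _≋_[mod_] : Carrier → Carrier → Carrier → Set (c ⊔ ℓ)
  a ≋ b [mod g ] = g ∣E (a - b)

  ≋-sym : ∀ {g a b} → a ≋ b [mod g ] → b ≋ a [mod g ]
  ≋-sym {a = a} {b} = ∣E-resp (⁻¹-anti-homo‿- a b) ∘′ ∣E-‿

  ≋-trans : ∀ {g a b e} → a ≋ b [mod g ] → b ≋ e [mod g ] → a ≋ e [mod g ]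
  ≋-trans {a = a} {b} {e} a≋b b≋e = ∣E-resp telescope (∣E-+ a≋b b≋e)
    where
    telescope : (a - b) + (b - e) ≈ a - e
    telescope = begin
      (a - b) + (b - e)   ≈⟨ +-assoc a (- b) (b - e) ⟩
      a + (- b + (b - e)) ≈⟨ +-congˡ (+-assoc (- b) b (- e)) ⟨
      a + ((- b + b) - e) ≈⟨ +-congˡ (+-congʳ (-‿inverseˡ b)) ⟩
      a + (0# - e)        ≈⟨ +-congˡ (+-identityˡ (- e)) ⟩
      a - e               ∎

  ≋0⇒∣E : ∀ {g a} → a ≋ 0# [mod g ] → g ∣E a
  ≋0⇒∣E {a = a} = ∣E-resp (trans (+-congˡ -0#≈0#) (+-identityʳ a))

  at0-+P : ∀ p q → at0 (p +P q) ≈ at0 p + at0 q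
  at0-+P []      q       = sym (+-identityˡ (at0 q))
  at0-+P (a ∷ p) []      = sym (+-identityʳ a)
  at0-+P (a ∷ p) (b ∷ q) = refl

  at0-negP : ∀ p → at0 (-P p) ≈ - at0 p
  at0-negP []      = sym -0#≈0#
  at0-negP (a ∷ p) = refl

  at0-·P : ∀ a p → at0 (a ·P p) ≈ a * at0 p
  at0-·P a []      = sym (zeroʳ a)
  at0-·P a (b ∷ p) = refl

  at0-*P : ∀ p q → at0 (p *P q) ≈ at0 p * at0 q
  at0-*P []      q = sym (zeroˡ (at0 q))
  at0-*P (a ∷ p) q = begin
    at0 ((a ·P q) +P (0# ∷ (p *P q))) ≈⟨ at0-+P (a ·P q) (0# ∷ (p *P q)) ⟩
    at0 (a ·P q) + 0#                 ≈⟨ +-identityʳ (at0 (a ·P q)) ⟩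
    at0 (a ·P q)                      ≈⟨ at0-·P a q ⟩
    a * at0 q                         ∎

  at0-subP : ∀ p q → at0 (p -P q) ≈ at0 p - at0 q
  at0-subP p q = trans (at0-+P p (-P q)) (+-congˡ (at0-negP q))

  ≡mod₂⇒at0-≋ : ∀ {g f h p q} → g ∣E at0 f → g ∣E at0 h →
                p ≡ q mod₂ f , h → at0 p ≋ at0 q [mod g ]
  ≡mod₂⇒at0-≋ {g} {f} {h} {p} {q} g∣f g∣h (u , v , p-q≈uf+vh) =
    ∣E-resp at0-uf+vh (∣E-+ (∣E-*ˡ (at0 u) g∣f) (∣E-*ˡ (at0 v) g∣h))
    where
    at0-uf+vh : at0 u * at0 f + at0 v * at0 h ≈ at0 p - at0 q
    at0-uf+vh = begin
      at0 u * at0 f + at0 v * at0 h ≈⟨ +-cong (at0-*P u f) (at0-*P v h) ⟨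
      at0 (u *P f) + at0 (v *P h)   ≈⟨ at0-+P (u *P f) (v *P h) ⟨
      at0 ((u *P f) +P (v *P h))    ≈⟨ p-q≈uf+vh 0 ⟨
      at0 (p -P q)                  ≈⟨ at0-subP p q ⟩
      at0 p - at0 q                 ∎

  ∣E-at0-xP : ∀ g → g ∣E at0 xP
  ∣E-at0-xP g = 0# , sym (zeroˡ g)

  covering-congruent-digits⇒at0-≋ :
    ∀ {g f₁ f₂ d̃} {N : List Pol} → g ∣E at0 f₁ → g ∣E at0 f₂ →
    (∀ a → Any (SameCosetX f₁ a) N) →
    All (λ d → d ≡ d̃ mod₂ f₁ , f₂) N →
    ∀ a → at0 a ≋ at0 d̃ [mod g ]
  covering-congruent-digits⇒at0-≋ {g} {d̃ = d̃} g∣f₁ g∣f₂ covers N≡d̃ a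
    with All.lookupAny N≡d̃ (covers a)
  ... | d≡d̃ , a≡d =
    ≋-trans (≡mod₂⇒at0-≋ {p = a} {q = d} (∣E-at0-xP g) g∣f₁ a≡d)
            (≡mod₂⇒at0-≋ {p = d} {q = d̃} g∣f₁ g∣f₂ d≡d̃)
    where
    d : Pol
    d = Any.lookup (covers a)

lemma3p6 : {c ℓ : Level} (E : CommutativeRing c ℓ) →
    let open Poly E in
    IsPID →
    (f₁ f₂ : Pol) → CoprimeP f₁ f₂ →
    FiniteQuot₂ f₁ f₂ →
    (N₁ N₂ : List Pol) →
    IrredundantDigitSystem f₁ N₁ → IrredundantDigitSystem f₂ N₂ →
    (∃ λ d̃ → All (λ d → d ≡ d̃ mod₂ f₁ , f₂) (N₁ ++ N₂)) →
    CoprimeE (at0 f₁) (at0 f₂)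
lemma3p6 E _ f₁ f₂ _ _ N₁ N₂ ds₁ _ (d̃ , N≡d̃) g g∣f₁ g∣f₂ =
  ≋0⇒∣E E (≋-trans E (at0≋d̃ oneP) (≋-sym E (at0≋d̃ [])))
  where
  open Poly E
  open IrredundantDigitSystem ds₁ using (covers)
  at0≋d̃ : ∀ a → _≋_[mod_] E (at0 a) (at0 d̃) g
  at0≋d̃ = covering-congruent-digits⇒at0-≋ E g∣f₁ g∣f₂ covers (++⁻ˡ N₁ N≡d̃)
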